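{- Let $n\ge 0$ and $\alpha\ge 1$ be integers, $N=2^{n+1}$, $c=2^\alpha+1$, and consider the $c$-DAG over the uniform dataset $\{0,1,\dots,N-1\}$ in the domain $[0,N)$. Let $s$ be a query length with $1\le s\le N$ and $\kappa=\lfloor\log_2(N/s)\rfloor$. If $2^{n-\kappa}<s\le\frac{c-2}{c-1}\,2^{n-\kappa+1}$, then for every valid start position $x\in[0,N-s]$, the SRC-search on the $c$-DAG for the query $Q=[x,x+s)$ returns a node at level $\kappa$.
   Context: Levels are depths, with the root at level $0$. For the uniform dataset $\{0,\dots,N-1\}$, $N=2^{n+1}$, the $c$-DAG ($c=2^\alpha+1$) has root with canonical interval $[0,N)$; each node with interval $[a,a+L)$ has $c$ children with intervals $[a,a+L/2)$, $[a+L/2,a+L)$ and, for $j=1,\dots,c-2$, $[a+jL/(2(c-1)),\,a+jL/(2(c-1))+L/2)$. Consequently the nodes at level $\ell$ are exactly the intervals $\left[m\frac{2^{n-\ell+1}}{c-1},(m+c-1)\frac{2^{n-\ell+1}}{c-1}\right)$ for $m=0,1,\dots,(c-1)2^\ell-(c-1)$; leaves (level $n+1$) are single points. A query $Q=[x,x+s)$ is contained in $[a,b)$ iff $a\le x$ and $x+s\le b$. SRC-search: starting from the root, descend into any child whose interval still fully contains $Q$; stop at a node none of whose children contains $Q$ and return it (ties broken by a fixed rule). -}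

module Defs where

open import Data.Nat using (ℕ; zero; suc; _+_; _*_; _∸_; _^_; _≤_; _<_; NonZero; _/_)
open import Data.Nat.Logarithm using (⌊log₂_⌋)
open import Data.Product using (_×_; ∃-syntax)
open import Relation.Nullary using (¬_)

N : ℕ → ℕ
N n = 2 ^ (suc n)

c : ℕ → ℕ
c α = 2 ^ α + 1

-- Node endpoints m·2^(n-ℓ+1)/(c-1) are in general not integers,
-- so we work with all coordinates multiplied by (c - 1) = 2^α.  Containment of
-- half-open intervals is invariant under this scaling.
--
-- A node of the c-DAG at level ℓ (0 ≤ ℓ ≤ n+1) is identified by its index m;
-- its canonical interval is [m·u, (m + c - 1)·u) with u = 2^(n-ℓ+1)/(c-1),
-- i.e. in scaled coordinates [ lo n ℓ m , hi n α ℓ m ):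
lo : ℕ → ℕ → ℕ → ℕ
lo n ℓ m = m * 2 ^ (suc n ∸ ℓ)

hi : ℕ → ℕ → ℕ → ℕ → ℕ
hi n α ℓ m = (m + 2 ^ α) * 2 ^ (suc n ∸ ℓ)

-- Query Q = [x, x+s) in scaled coordinates is [x·2^α, (x+s)·2^α).
-- Q ⊆ [a,b)  iff  a ≤ x and x + s ≤ b.
Contains : (n α s x ℓ m : ℕ) → Set
Contains n α s x ℓ m = lo n ℓ m ≤ x * 2 ^ α × (x + s) * 2 ^ α ≤ hi n α ℓ m

-- A node [a, a+L) at level ℓ ≤ n (non-leaf) has c children
-- [a + j·L/(2(c-1)), a + j·L/(2(c-1)) + L/2) for j = 0, 1, …, c-1
-- (j = 0 is the left half, j = c-1 the right half, 1 ≤ j ≤ c-2 the shifted ones).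
-- With a = m·u, L = (c-1)·u, these are exactly the level-(ℓ+1) nodes with
-- index 2m + j (unit u/2).  Leaves (level n+1) have no children.
data Child (n α : ℕ) : (ℓ m ℓ' m' : ℕ) → Set where
  child : ∀ {ℓ m} j → ℓ ≤ n → j ≤ 2 ^ α → Child n α ℓ m (suc ℓ) (2 * m + j)

-- Nodes visited by SRC-search for Q = [x, x+s): start at the root (level 0,
-- index 0, interval [0,N)) provided it contains Q, and descend into any child
-- that still contains Q.  (Quantifying over all such descents covers every
-- fixed tie-breaking rule.)
data Visited (n α s x : ℕ) : (ℓ m : ℕ) → Set where
  root : Contains n α s x 0 0 → Visited n α s x 0 0
  step : ∀ {ℓ m ℓ' m'} → Visited n α s x ℓ m → Child n α ℓ m ℓ' m'
       → Contains n α s x ℓ' m' → Visited n α s x ℓ' m'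

SRCResult : (n α s x ℓ m : ℕ) → Set
SRCResult n α s x ℓ m =
  Visited n α s x ℓ m ×
  (∀ ℓ' m' → Child n α ℓ m ℓ' m' → ¬ Contains n α s x ℓ' m')

-- κ = ⌊log₂(N/s)⌋  (= ⌊log₂ ⌊N/s⌋⌋).
κ : (n s : ℕ) → .{{_ : NonZero s}} → ℕ
κ n s = ⌊log₂ (N n / s) ⌋

{-# OPTIONS --safe #-}
module Submission where

-- In the scaled coordinates of Defs, a level-ℓ node m (ℓ ≤ n) is [2m·u, (2m + 2A)·u) with
-- u = 2^(n-ℓ) and A = 2^α, and its children are the windows [(2m+j)·u, (2m+j+A)·u), 0 ≤ j ≤ A.
-- Any subinterval of the node of length at most (A-1)·u lies in one of these windows, and the
-- upper bound on s gives exactly this for the query at every level ℓ < κ: the search cannot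
-- stop above level κ.  Conversely a node of level ℓ containing the query has s ≤ 2^(n+1-ℓ),
-- which the lower bound on s rules out for ℓ > κ.

open import Defs
open import Data.Nat using (ℕ; zero; suc; _+_; _*_; _∸_; _^_; _≤_; _<_; NonZero; >-nonZero⁻¹; z≤n; s≤s; _≤?_)
open import Data.Nat.Properties
open import Data.Nat.Tactic.RingSolver using (solve-∀)
open import Data.Product using (_×_; _,_; ∃-syntax; ∃₂)
open import Relation.Nullary using (¬_; yes; no; contradiction)
open import Relation.Binary.PropositionalEquality
  using (_≡_; sym; trans; cong; subst; subst₂)

-- Y + U ≤ X + A * U says that [X, Y) has length at most (A-1)·U; the witness is the first
-- window whose right end reaches Y.
sliding-window : ∀ U A X Y → Y + U ≤ X + A * U →
  ∀ w p → p * U ≤ X → Y ≤ (p + w + A) * U →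
  ∃[ j ] (j ≤ w × (p + j) * U ≤ X × Y ≤ (p + j + A) * U)
sliding-window U A X Y narrow w p pU≤X Y≤ with Y ≤? (p + A) * U
... | yes Y≤′ = 0 , z≤n , subst (λ q → q * U ≤ X) (sym (+-identityʳ p)) pU≤X ,
                         subst (λ q → Y ≤ (q + A) * U) (sym (+-identityʳ p)) Y≤′
sliding-window U A X Y narrow zero p pU≤X Y≤ | no Y≰ =
  contradiction (subst (λ q → Y ≤ (q + A) * U) (+-identityʳ p) Y≤) Y≰
sliding-window U A X Y narrow (suc w) p pU≤X Y≤ | no Y≰
  with sliding-window U A X Y narrow w (suc p) next
         (subst (λ q → Y ≤ (q + A) * U) (+-suc p w) Y≤)
  where
  open ≤-Reasoning
  next : suc p * U ≤ X
  next = +-cancelʳ-≤ (A * U) (suc p * U) X (<⇒≤ (begin-strict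
    suc p * U + A * U   ≡⟨ +-assoc U (p * U) (A * U) ⟩
    U + (p * U + A * U) ≡⟨ cong (U +_) (*-distribʳ-+ U p A) ⟨
    U + (p + A) * U     <⟨ +-monoʳ-< U (≰⇒> Y≰) ⟩
    U + Y               ≡⟨ +-comm U Y ⟩
    Y + U               ≤⟨ narrow ⟩
    X + A * U           ∎))
... | j , j≤w , lo≤ , ≤hi =
  suc j , s≤s j≤w ,
  subst (λ q → q * U ≤ X) (sym (+-suc p j)) lo≤ ,
  subst (λ q → Y ≤ (q + A) * U) (sym (+-suc p j)) ≤hi

pred[m]*n<m*n : ∀ m n .{{_ : NonZero m}} .{{_ : NonZero n}} → (m ∸ 1) * n < m * n
pred[m]*n<m*n (suc m) n = m<n+m (m * n) (>-nonZero⁻¹ n)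

m≤pred[n]*o⇒m+o≤n*o : ∀ {m} n o .{{_ : NonZero n}} → m ≤ (n ∸ 1) * o → m + o ≤ n * o
m≤pred[n]*o⇒m+o≤n*o {m} (suc n) o m≤no = subst (m + o ≤_) (+-comm (n * o) o) (+-monoˡ-≤ o m≤no)

m*2^k≤pred[m]*2^[1+n]⇒k≤n : ∀ m {k n} .{{_ : NonZero m}} →
  m * 2 ^ k ≤ (m ∸ 1) * 2 ^ suc n → k ≤ n
m*2^k≤pred[m]*2^[1+n]⇒k≤n m {k} {n} le = ≮⇒≥ λ n<k →
  <⇒≱ (pred[m]*n<m*n m (2 ^ suc n)) (≤-trans (*-monoʳ-≤ m (^-monoʳ-≤ 2 n<k)) le)
  where
  instance
    2^[1+n]≢0 : NonZero (2 ^ suc n)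
    2^[1+n]≢0 = m^n≢0 2 (suc n)

m*2^k≤o*2^[1+n]⇒m≤o*2^[n∸ℓ] : ∀ m o {k n ℓ} → m * 2 ^ k ≤ o * 2 ^ suc n →
  ℓ < k → ℓ ≤ n → m ≤ o * 2 ^ (n ∸ ℓ)
m*2^k≤o*2^[1+n]⇒m≤o*2^[n∸ℓ] m o {k} {n} {ℓ} le ℓ<k ℓ≤n =
  *-cancelʳ-≤ m (o * 2 ^ (n ∸ ℓ)) (2 ^ k) {{m^n≢0 2 k}} (begin
    m * 2 ^ k                 ≤⟨ le ⟩
    o * 2 ^ suc n             ≤⟨ *-monoʳ-≤ o (^-monoʳ-≤ 2 1+n≤n∸ℓ+k) ⟩
    o * 2 ^ (n ∸ ℓ + k)       ≡⟨ cong (o *_) (^-distribˡ-+-* 2 (n ∸ ℓ) k) ⟩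
    o * (2 ^ (n ∸ ℓ) * 2 ^ k) ≡⟨ *-assoc o (2 ^ (n ∸ ℓ)) (2 ^ k) ⟨
    o * 2 ^ (n ∸ ℓ) * 2 ^ k   ∎)
  where
  open ≤-Reasoning
  1+n≤n∸ℓ+k : suc n ≤ n ∸ ℓ + k
  1+n≤n∸ℓ+k = subst (_≤ n ∸ ℓ + k) (trans (+-suc (n ∸ ℓ) ℓ) (cong suc (m∸n+n≡m ℓ≤n)))
                (+-monoʳ-≤ (n ∸ ℓ) ℓ<k)

c∸1≡2^α : ∀ α → c α ∸ 1 ≡ 2 ^ α
c∸1≡2^α α = m+n∸n≡m (2 ^ α) 1

c∸2≡2^α∸1 : ∀ α → c α ∸ 2 ≡ 2 ^ α ∸ 1
c∸2≡2^α∸1 α = cong (_∸ 2) (+-comm (2 ^ α) 1)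

lo≡lo-first-child : ∀ n {ℓ} m → ℓ ≤ n → lo n ℓ m ≡ lo n (suc ℓ) (2 * m)
lo≡lo-first-child n {ℓ} m ℓ≤n =
  trans (cong (λ e → m * 2 ^ e) (+-∸-assoc 1 ℓ≤n)) (doubling m (2 ^ (n ∸ ℓ)))
  where
  doubling : ∀ m u → m * (2 * u) ≡ 2 * m * u
  doubling = solve-∀

hi≡hi-last-child : ∀ n α {ℓ} m → ℓ ≤ n → hi n α ℓ m ≡ hi n α (suc ℓ) (2 * m + 2 ^ α)
hi≡hi-last-child n α {ℓ} m ℓ≤n =
  trans (cong (λ e → (m + 2 ^ α) * 2 ^ e) (+-∸-assoc 1 ℓ≤n)) (doubling m (2 ^ α) (2 ^ (n ∸ ℓ)))
  where
  doubling : ∀ m a u → (m + a) * (2 * u) ≡ (2 * m + a + a) * u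
  doubling = solve-∀

module Search (n α s x : ℕ) where

  visited⇒contains : ∀ {ℓ m} → Visited n α s x ℓ m → Contains n α s x ℓ m
  visited⇒contains (root contains)     = contains
  visited⇒contains (step _ _ contains) = contains

  visited⇒ℓ≤1+n : ∀ {ℓ m} → Visited n α s x ℓ m → ℓ ≤ suc n
  visited⇒ℓ≤1+n (root _)                  = z≤n
  visited⇒ℓ≤1+n (step _ (child _ ℓ≤n _) _) = s≤s ℓ≤n

  contains⇒s≤2^[1+n∸ℓ] : ∀ ℓ m → Contains n α s x ℓ m → s ≤ 2 ^ (suc n ∸ ℓ)
  contains⇒s≤2^[1+n∸ℓ] ℓ m (lo≤ , ≤hi) =
    *-cancelʳ-≤ s u A {{m^n≢0 2 α}} (+-cancelˡ-≤ (x * A) (s * A) (u * A) (begin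
      x * A + s * A ≡⟨ *-distribʳ-+ A x s ⟨
      (x + s) * A   ≤⟨ ≤hi ⟩
      (m + A) * u   ≡⟨ *-distribʳ-+ u m A ⟩
      m * u + A * u ≤⟨ +-mono-≤ lo≤ (≤-reflexive (*-comm A u)) ⟩
      x * A + u * A ∎))
    where
    open ≤-Reasoning
    A u : ℕ
    A = 2 ^ α
    u = 2 ^ (suc n ∸ ℓ)

  visited⇒ℓ≤K : ∀ K → 2 ^ suc n < s * 2 ^ suc K → ∀ {ℓ m} → Visited n α s x ℓ m → ℓ ≤ K
  visited⇒ℓ≤K K N<s*2^[1+K] {ℓ} {m} visited = ≮⇒≥ λ K<ℓ → <⇒≱ N<s*2^[1+K] (begin
    s * 2 ^ suc K                ≤⟨ *-monoʳ-≤ s (^-monoʳ-≤ 2 K<ℓ) ⟩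
    s * 2 ^ ℓ                    ≤⟨ *-monoˡ-≤ (2 ^ ℓ) (contains⇒s≤2^[1+n∸ℓ] ℓ m (visited⇒contains visited)) ⟩
    2 ^ (suc n ∸ ℓ) * 2 ^ ℓ      ≡⟨ ^-distribˡ-+-* 2 (suc n ∸ ℓ) ℓ ⟨
    2 ^ (suc n ∸ ℓ + ℓ)          ≡⟨ cong (2 ^_) (m∸n+n≡m (visited⇒ℓ≤1+n visited)) ⟩
    2 ^ suc n                    ∎)
    where open ≤-Reasoning

  contains⇒child-contains : ∀ {ℓ} m → ℓ ≤ n →
    s * 2 ^ α + 2 ^ (n ∸ ℓ) ≤ 2 ^ α * 2 ^ (n ∸ ℓ) → Contains n α s x ℓ m →
    ∃₂ λ ℓ′ m′ → Child n α ℓ m ℓ′ m′ × Contains n α s x ℓ′ m′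
  contains⇒child-contains {ℓ} m ℓ≤n narrow (lo≤ , ≤hi)
    with sliding-window u A (x * A) ((x + s) * A) narrow′ A (2 * m)
           (subst (_≤ x * A) (lo≡lo-first-child n m ℓ≤n) lo≤)
           (subst ((x + s) * A ≤_) (hi≡hi-last-child n α m ℓ≤n) ≤hi)
    where
    open ≤-Reasoning
    A u : ℕ
    A = 2 ^ α
    u = 2 ^ (n ∸ ℓ)
    narrow′ : (x + s) * A + u ≤ x * A + A * u
    narrow′ = begin
      (x + s) * A + u     ≡⟨ cong (_+ u) (*-distribʳ-+ A x s) ⟩
      x * A + s * A + u   ≡⟨ +-assoc (x * A) (s * A) u ⟩
      x * A + (s * A + u) ≤⟨ +-monoʳ-≤ (x * A) narrow ⟩
      x * A + A * u       ∎
  ... | j , j≤A , lo≤′ , ≤hi′ = suc ℓ , 2 * m + j , child j ℓ≤n j≤A , lo≤′ , ≤hi′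

lemma2 : (n α : ℕ) → 1 ≤ α → (s : ℕ) → .{{_ : NonZero s}} → s ≤ N n →
    2 ^ suc n < s * 2 ^ suc (κ n s) →
    s * (c α ∸ 1) * 2 ^ κ n s ≤ (c α ∸ 2) * 2 ^ suc n →
    (x : ℕ) → x + s ≤ N n →
    (ℓ m : ℕ) → SRCResult n α s x ℓ m → ℓ ≡ κ n s
-- α ≥ 1 is implied by the upper bound on s (for α = 0 it reads s·2^κ ≤ 0), and the
-- containment of the query in the root is part of Visited.
lemma2 n α _ s _ lower upper x _ ℓ m (visited , childless) =
  ≤-antisym (visited⇒ℓ≤K (κ n s) lower visited) (≮⇒≥ no-child-below-κ)
  where
  open Search n α s x
  instance
    2^α≢0 : NonZero (2 ^ α)
    2^α≢0 = m^n≢0 2 α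
  upper′ : s * 2 ^ α * 2 ^ κ n s ≤ (2 ^ α ∸ 1) * 2 ^ suc n
  upper′ = subst₂ (λ a b → s * a * 2 ^ κ n s ≤ b * 2 ^ suc n) (c∸1≡2^α α) (c∸2≡2^α∸1 α) upper
  κ≤n : κ n s ≤ n
  κ≤n = m*2^k≤pred[m]*2^[1+n]⇒k≤n (2 ^ α)
          (≤-trans (*-monoˡ-≤ (2 ^ κ n s) (m≤n*m (2 ^ α) s)) upper′)
  narrow : ℓ < κ n s → ℓ ≤ n → s * 2 ^ α + 2 ^ (n ∸ ℓ) ≤ 2 ^ α * 2 ^ (n ∸ ℓ)
  narrow ℓ<κ ℓ≤n = m≤pred[n]*o⇒m+o≤n*o (2 ^ α) (2 ^ (n ∸ ℓ))
    (m*2^k≤o*2^[1+n]⇒m≤o*2^[n∸ℓ] (s * 2 ^ α) (2 ^ α ∸ 1) upper′ ℓ<κ ℓ≤n)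
  no-child-below-κ : ¬ ℓ < κ n s
  no-child-below-κ ℓ<κ
    with ℓ≤n ← ≤-trans (<⇒≤ ℓ<κ) κ≤n
    with contains⇒child-contains m ℓ≤n (narrow ℓ<κ ℓ≤n) (visited⇒contains visited)
  ... | ℓ′ , m′ , child-of , contains = childless ℓ′ m′ child-of contains
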